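{- Let $V=(v_{n,k})_{n,k\ge0}$ be the vertical half of the Riordan array $(1+x,\ x(1+x)^2)$. Then for every $n\ge 0$, $\sum_{k=0}^{n} v_{n,k}=4^n$.
   Context: A Riordan array is a pair $(g(x),f(x))$ of formal power series with $g(0)\neq 0$, $f(0)=0$, $f'(0)\neq 0$; it is identified with the infinite lower triangular matrix $(t_{n,k})_{n,k\ge 0}$, $t_{n,k}=[x^n]g(x)f(x)^k$. The vertical half of a Riordan array with matrix $(t_{n,k})$ is the matrix whose $(n,k)$ entry is $t_{2n-k,n}$ (with $t_{i,j}=0$ for $j>i$). The row sums of a lower triangular matrix are the sums of the entries of each row. -}

module Defs where

open import Data.Nat using (ℕ; zero; suc; _+_; _*_; _∸_; _≤?_)
open import Relation.Nullary using (yes; no)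

-- Formal power series with natural-number coefficients, represented by
-- their coefficient sequence: a series s is the function n ↦ [x^n] s.
Series : Set
Series = ℕ → ℕ

sumTo : ℕ → (ℕ → ℕ) → ℕ
sumTo zero    f = f zero
sumTo (suc n) f = sumTo n f + f (suc n)

_⊛_ : Series → Series → Series
(a ⊛ b) n = sumTo n (λ i → a i * b (n ∸ i))

one : Series
one zero    = 1
one (suc _) = 0

pow : Series → ℕ → Series
pow f zero    = one
pow f (suc k) = f ⊛ pow f k

riordan : Series → Series → ℕ → ℕ → ℕ
riordan g f n k = (g ⊛ pow f k) n

onePlusX : Series
onePlusX zero          = 1
onePlusX (suc zero)    = 1
onePlusX (suc (suc _)) = 0

xSeries : Series
xSeries zero          = 0
xSeries (suc zero)    = 1
xSeries (suc (suc _)) = 0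

xOnePlusXSq : Series
xOnePlusXSq = xSeries ⊛ (onePlusX ⊛ onePlusX)

-- vertical half of a lower triangular matrix t: entry (n,k) is t_{2n-k, n},
-- taken to be 0 when n > 2n - k (i.e. k > n), and also 0 when k > 2n.
verticalHalf : (ℕ → ℕ → ℕ) → ℕ → ℕ → ℕ
verticalHalf t n k with k ≤? n
... | yes _ = t ((n + n) ∸ k) n
... | no  _ = 0

V : ℕ → ℕ → ℕ
V = verticalHalf (riordan onePlusX xOnePlusXSq)

-- Column n of the Riordan array (1 + x, x(1 + x)²) is x^n (1 + x)^(2n+1), so
-- v(n,k) = C(2n+1, n-k) and the n-th row sum of V is the sum of the first half of
-- row 2n + 1 of Pascal's triangle. That row is symmetric, so this is half of
-- 2^(2n+1), i.e. 4^n.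
module Submission where

open import Defs
open import Data.Nat using (ℕ; _^_)
open import Relation.Binary.PropositionalEquality using (_≡_)
open import Data.Nat using (zero; suc; _+_; _*_; _∸_; _≤_; _<_; _≤?_; z≤n; s≤s)
open import Data.Nat.Properties
open import Data.Nat.Combinatorics using (_C_; nCk≡nC[n∸k]; nCk+nC[k+1]≡[n+1]C[k+1]; k>n⇒nCk≡0)
open import Data.Nat.Solver using (module +-*-Solver)
open import Relation.Binary.PropositionalEquality using (_≗_; refl; sym; trans; cong; cong₂; module ≡-Reasoning)
open import Relation.Nullary using (yes; no)
open import Relation.Nullary.Negation using (contradiction)

open ≡-Reasoning

sumTo-cong : ∀ n {f g : ℕ → ℕ} → (∀ i → i ≤ n → f i ≡ g i) → sumTo n f ≡ sumTo n g
sumTo-cong zero    f≡g = f≡g 0 z≤n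
sumTo-cong (suc n) f≡g =
  cong₂ _+_ (sumTo-cong n (λ i i≤n → f≡g i (m≤n⇒m≤1+n i≤n))) (f≡g (suc n) ≤-refl)

sumTo-+ : ∀ n (f g : ℕ → ℕ) → sumTo n (λ i → f i + g i) ≡ sumTo n f + sumTo n g
sumTo-+ zero    f g = refl
sumTo-+ (suc n) f g = begin
  sumTo n (λ i → f i + g i) + (f (suc n) + g (suc n))
    ≡⟨ cong (_+ (f (suc n) + g (suc n))) (sumTo-+ n f g) ⟩
  sumTo n f + sumTo n g + (f (suc n) + g (suc n))
    ≡⟨ solve 4 (λ a b c d → a :+ b :+ (c :+ d) := a :+ c :+ (b :+ d)) refl
         (sumTo n f) (sumTo n g) (f (suc n)) (g (suc n)) ⟩
  sumTo n f + f (suc n) + (sumTo n g + g (suc n)) ∎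
  where open +-*-Solver

sumTo-suc : ∀ n (f : ℕ → ℕ) → sumTo (suc n) f ≡ f 0 + sumTo n (λ i → f (suc i))
sumTo-suc zero    f = refl
sumTo-suc (suc n) f = trans (cong (_+ f (suc (suc n))) (sumTo-suc n f)) (+-assoc (f 0) _ _)

sumTo-++ : ∀ k m (f : ℕ → ℕ) → sumTo (k + suc m) f ≡ sumTo m f + sumTo k (λ i → f (i + suc m))
sumTo-++ zero    m f = refl
sumTo-++ (suc k) m f =
  trans (cong (_+ f (suc k + suc m)) (sumTo-++ k m f)) (+-assoc (sumTo m f) _ _)

sumTo-vanish : ∀ {m} (f : ℕ → ℕ) → (∀ i → m < i → f i ≡ 0) → ∀ k → sumTo (k + m) f ≡ sumTo m f
sumTo-vanish f f>m≡0 zero    = refl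
sumTo-vanish {m} f f>m≡0 (suc k) = begin
  sumTo (k + m) f + f (suc k + m) ≡⟨ cong₂ _+_ (sumTo-vanish f f>m≡0 k) (f>m≡0 _ (s≤s (m≤n+m m k))) ⟩
  sumTo m f + 0                   ≡⟨ +-identityʳ _ ⟩
  sumTo m f                       ∎

sumTo-reverse : ∀ n (f : ℕ → ℕ) → sumTo n (λ k → f (n ∸ k)) ≡ sumTo n f
sumTo-reverse zero    f = refl
sumTo-reverse (suc n) f = begin
  sumTo n (λ k → f (suc n ∸ k)) + f (n ∸ n)
    ≡⟨ cong₂ _+_ (sumTo-cong n (λ k k≤n → cong f (+-∸-assoc 1 k≤n))) (cong f (n∸n≡0 n)) ⟩
  sumTo n (λ k → f (suc (n ∸ k))) + f 0
    ≡⟨ cong (_+ f 0) (sumTo-reverse n (λ i → f (suc i))) ⟩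
  sumTo n (λ i → f (suc i)) + f 0
    ≡⟨ +-comm _ (f 0) ⟩
  f 0 + sumTo n (λ i → f (suc i))
    ≡⟨ sumTo-suc n f ⟨
  sumTo (suc n) f ∎

-- shift i a is the series x^i a(x)
shift : ℕ → Series → Series
shift zero    a m       = a m
shift (suc i) a zero    = 0
shift (suc i) a (suc m) = shift i a m

shift-cong : ∀ i {a b : Series} → a ≗ b → shift i a ≗ shift i b
shift-cong zero    a≗b m       = a≗b m
shift-cong (suc i) a≗b zero    = refl
shift-cong (suc i) a≗b (suc m) = shift-cong i a≗b m

shift-+ : ∀ i (a : Series) j → shift i a (i + j) ≡ a j
shift-+ zero    a j = refl
shift-+ (suc i) a j = shift-+ i a j

shift-∸ : ∀ {i m} (a : Series) → i ≤ m → shift i a m ≡ a (m ∸ i)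
shift-∸ a z≤n       = refl
shift-∸ a (s≤s i≤m) = shift-∸ a i≤m

shift-< : ∀ {i m} (a : Series) → m < i → shift i a m ≡ 0
shift-< {suc i} {zero}  a m<i       = refl
shift-< {suc i} {suc m} a (s≤s m<i) = shift-< a m<i

shift-shift : ∀ k (a : Series) → shift 1 (shift k a) ≗ shift (suc k) a
shift-shift k a zero    = refl
shift-shift k a (suc m) = refl

⊛-congʳ : ∀ (c : Series) {a b : Series} → a ≗ b → (c ⊛ a) ≗ (c ⊛ b)
⊛-congʳ c a≗b m = sumTo-cong m (λ i _ → cong (c i *_) (a≗b (m ∸ i)))

⊛-polynomial : ∀ d {c : Series} (a : Series) → (∀ i → d < i → c i ≡ 0) →
               ∀ m → (c ⊛ a) m ≡ sumTo d (λ i → c i * shift i a m)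
⊛-polynomial d {c} a deg≤d m = begin
  (c ⊛ a) m        ≡⟨ sumTo-cong m (λ i i≤m → cong (c i *_) (sym (shift-∸ a i≤m))) ⟩
  sumTo m h        ≡⟨ sumTo-vanish h (λ i m<i → trans (cong (c i *_) (shift-< a m<i)) (*-zeroʳ (c i))) d ⟨
  sumTo (d + m) h  ≡⟨ cong (λ n → sumTo n h) (+-comm d m) ⟩
  sumTo (m + d) h  ≡⟨ sumTo-vanish h (λ i d<i → cong (_* shift i a m) (deg≤d i d<i)) m ⟩
  sumTo d h        ∎
  where
  h : ℕ → ℕ
  h i = c i * shift i a m

onePlusX-⊛ : ∀ (a : Series) m → (onePlusX ⊛ a) m ≡ a m + shift 1 a m
onePlusX-⊛ a m = trans (⊛-polynomial 1 a degree≤1 m) (cong₂ _+_ (*-identityˡ (a m)) (*-identityˡ (shift 1 a m)))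
  where
  degree≤1 : ∀ i → 1 < i → onePlusX i ≡ 0
  degree≤1 _ (s≤s (s≤s _)) = refl

shift-onePlusX-⊛ : ∀ k (a : Series) m → shift k (onePlusX ⊛ a) m ≡ shift k a m + shift (suc k) a m
shift-onePlusX-⊛ zero    a m       = onePlusX-⊛ a m
shift-onePlusX-⊛ (suc k) a zero    = refl
shift-onePlusX-⊛ (suc k) a (suc m) = shift-onePlusX-⊛ k a m

onePlusX-⊛-shift : ∀ k (a : Series) → onePlusX ⊛ shift k a ≗ shift k (onePlusX ⊛ a)
onePlusX-⊛-shift k a m = begin
  (onePlusX ⊛ shift k a) m              ≡⟨ onePlusX-⊛ (shift k a) m ⟩
  shift k a m + shift 1 (shift k a) m   ≡⟨ cong (shift k a m +_) (shift-shift k a m) ⟩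
  shift k a m + shift (suc k) a m       ≡⟨ shift-onePlusX-⊛ k a m ⟨
  shift k (onePlusX ⊛ a) m              ∎

xSeries-⊛ : ∀ (a : Series) m → (xSeries ⊛ a) m ≡ shift 1 a m
xSeries-⊛ a m = trans (⊛-polynomial 1 a degree≤1 m) (*-identityˡ (shift 1 a m))
  where
  degree≤1 : ∀ i → 1 < i → xSeries i ≡ 0
  degree≤1 _ (s≤s (s≤s _)) = refl

xOnePlusXSq-degree≤3 : ∀ i → 3 < i → xOnePlusXSq i ≡ 0
xOnePlusXSq-degree≤3 (suc (suc (suc (suc i)))) (s≤s (s≤s (s≤s (s≤s _)))) = begin
  xOnePlusXSq (4 + i)                 ≡⟨ xSeries-⊛ (onePlusX ⊛ onePlusX) (4 + i) ⟩
  (onePlusX ⊛ onePlusX) (3 + i)       ≡⟨ onePlusX-⊛ onePlusX (3 + i) ⟩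
  0                                   ∎

-- The one instance of associativity of ⊛ that the computation of powers needs.
xOnePlusXSq-⊛ : ∀ (b : Series) → xOnePlusXSq ⊛ b ≗ shift 1 (onePlusX ⊛ (onePlusX ⊛ b))
xOnePlusXSq-⊛ b zero    = refl
xOnePlusXSq-⊛ b (suc m) = begin
  (xOnePlusXSq ⊛ b) (suc m)
    ≡⟨ ⊛-polynomial 3 b xOnePlusXSq-degree≤3 (suc m) ⟩
  0 * b (suc m) + 1 * b m + 2 * shift 1 b m + 1 * shift 2 b m
    ≡⟨ solve 4 (λ x y z w → con 0 :* x :+ con 1 :* y :+ con 2 :* z :+ con 1 :* w
                            := y :+ z :+ (z :+ w)) refl (b (suc m)) (b m) (shift 1 b m) (shift 2 b m) ⟩
  b m + shift 1 b m + (shift 1 b m + shift 2 b m)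
    ≡⟨ cong₂ _+_ (onePlusX-⊛ b m) (shift-onePlusX-⊛ 1 b m) ⟨
  (onePlusX ⊛ b) m + shift 1 (onePlusX ⊛ b) m
    ≡⟨ onePlusX-⊛ (onePlusX ⊛ b) m ⟨
  (onePlusX ⊛ (onePlusX ⊛ b)) m ∎
  where open +-*-Solver

pow-onePlusX : ∀ N j → pow onePlusX N j ≡ N C j
pow-onePlusX zero    zero    = refl
pow-onePlusX zero    (suc j) = refl
pow-onePlusX (suc N) j = begin
  (onePlusX ⊛ pow onePlusX N) j                 ≡⟨ onePlusX-⊛ (pow onePlusX N) j ⟩
  pow onePlusX N j + shift 1 (pow onePlusX N) j ≡⟨ pascal j ⟩
  suc N C j                                     ∎
  where
  pascal : ∀ j → pow onePlusX N j + shift 1 (pow onePlusX N) j ≡ suc N C j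
  pascal zero    = trans (+-identityʳ _) (pow-onePlusX N 0)
  pascal (suc j) = begin
    pow onePlusX N (suc j) + pow onePlusX N j ≡⟨ cong₂ _+_ (pow-onePlusX N (suc j)) (pow-onePlusX N j) ⟩
    N C suc j + N C j                         ≡⟨ +-comm (N C suc j) (N C j) ⟩
    N C j + N C suc j                         ≡⟨ nCk+nC[k+1]≡[n+1]C[k+1] N j ⟩
    suc N C suc j                             ∎

pow-xOnePlusXSq : ∀ k → pow xOnePlusXSq k ≗ shift k (pow onePlusX (k + k))
pow-xOnePlusXSq zero    m = refl
pow-xOnePlusXSq (suc k) m = begin
  (xOnePlusXSq ⊛ pow xOnePlusXSq k) m                     ≡⟨ ⊛-congʳ xOnePlusXSq (pow-xOnePlusXSq k) m ⟩
  (xOnePlusXSq ⊛ shift k B) m                             ≡⟨ xOnePlusXSq-⊛ (shift k B) m ⟩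
  shift 1 (onePlusX ⊛ (onePlusX ⊛ shift k B)) m           ≡⟨ shift-cong 1 commute m ⟩
  shift 1 (shift k (onePlusX ⊛ (onePlusX ⊛ B))) m         ≡⟨ shift-shift k _ m ⟩
  shift (suc k) (pow onePlusX (suc (suc (k + k)))) m      ≡⟨ cong (λ N → shift (suc k) (pow onePlusX N) m) (+-suc (suc k) k) ⟨
  shift (suc k) (pow onePlusX (suc k + suc k)) m          ∎
  where
  B : Series
  B = pow onePlusX (k + k)
  commute : onePlusX ⊛ (onePlusX ⊛ shift k B) ≗ shift k (onePlusX ⊛ (onePlusX ⊛ B))
  commute m = trans (⊛-congʳ onePlusX (onePlusX-⊛-shift k B) m) (onePlusX-⊛-shift k (onePlusX ⊛ B) m)

riordan-column : ∀ k m → riordan onePlusX xOnePlusXSq m k ≡ shift k (pow onePlusX (suc (k + k))) m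
riordan-column k m = begin
  (onePlusX ⊛ pow xOnePlusXSq k) m              ≡⟨ ⊛-congʳ onePlusX (pow-xOnePlusXSq k) m ⟩
  (onePlusX ⊛ shift k (pow onePlusX (k + k))) m ≡⟨ onePlusX-⊛-shift k (pow onePlusX (k + k)) m ⟩
  shift k (pow onePlusX (suc (k + k))) m        ∎

V-entry : ∀ n k → k ≤ n → V n k ≡ suc (n + n) C (n ∸ k)
V-entry n k k≤n with k ≤? n
... | no k≰n = contradiction k≤n k≰n
... | yes _  = begin
  riordan onePlusX xOnePlusXSq (n + n ∸ k) n ≡⟨ riordan-column n (n + n ∸ k) ⟩
  shift n P (n + n ∸ k)                      ≡⟨ cong (shift n P) (+-∸-assoc n k≤n) ⟩
  shift n P (n + (n ∸ k))                    ≡⟨ shift-+ n P (n ∸ k) ⟩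
  P (n ∸ k)                                  ≡⟨ pow-onePlusX (suc (n + n)) (n ∸ k) ⟩
  suc (n + n) C (n ∸ k)                      ∎
  where
  P : Series
  P = pow onePlusX (suc (n + n))

sumTo-binomial : ∀ N → sumTo N (N C_) ≡ 2 ^ N
sumTo-binomial zero    = refl
sumTo-binomial (suc N) = begin
  sumTo (suc N) (suc N C_)         ≡⟨ sumTo-suc N (suc N C_) ⟩
  1 + sumTo N (λ j → suc N C suc j) ≡⟨ cong (1 +_) pascal ⟩
  1 + (S + T)                      ≡⟨ solve 3 (λ o s t → o :+ (s :+ t) := s :+ (o :+ t)) refl 1 S T ⟩
  S + (1 + T)                      ≡⟨ cong (S +_) (sumTo-suc N (N C_)) ⟨
  S + (S + N C suc N)              ≡⟨ cong (λ x → S + (S + x)) (k>n⇒nCk≡0 (n<1+n N)) ⟩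
  S + (S + 0)                      ≡⟨ cong (λ x → x + (x + 0)) (sumTo-binomial N) ⟩
  2 ^ suc N                        ∎
  where
  open +-*-Solver
  S T : ℕ
  S = sumTo N (N C_)
  T = sumTo N (λ j → N C suc j)
  pascal : sumTo N (λ j → suc N C suc j) ≡ S + T
  pascal = trans (sumTo-cong N (λ j _ → sym (nCk+nC[k+1]≡[n+1]C[k+1] N j))) (sumTo-+ N (N C_) (λ j → N C suc j))

sumTo-binomial-upper-half : ∀ n → sumTo n (λ i → suc (n + n) C (i + suc n)) ≡ sumTo n (suc (n + n) C_)
sumTo-binomial-upper-half n = begin
  sumTo n (λ i → N C (i + suc n))       ≡⟨ sumTo-reverse n (λ i → N C (i + suc n)) ⟨
  sumTo n (λ i → N C (n ∸ i + suc n))   ≡⟨ sumTo-cong n (λ i i≤n → cong (N C_) (reflect i≤n)) ⟩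
  sumTo n (λ i → N C (N ∸ i))           ≡⟨ sumTo-cong n (λ i i≤n → sym (nCk≡nC[n∸k] (i≤N i≤n))) ⟩
  sumTo n (N C_)                        ∎
  where
  N : ℕ
  N = suc (n + n)
  reflect : ∀ {i} → i ≤ n → n ∸ i + suc n ≡ N ∸ i
  reflect {i} i≤n = trans (sym (+-∸-comm (suc n) i≤n)) (cong (_∸ i) (+-suc n n))
  i≤N : ∀ {i} → i ≤ n → i ≤ N
  i≤N i≤n = m≤n⇒m≤1+n (≤-trans i≤n (m≤m+n n n))

sumTo-binomial-lower-half : ∀ n → sumTo n (suc (n + n) C_) ≡ 4 ^ n
sumTo-binomial-lower-half n = *-cancelˡ-≡ H (4 ^ n) 2 (begin
  2 * H                                             ≡⟨ cong (H +_) (+-identityʳ H) ⟩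
  H + H                                             ≡⟨ cong (H +_) (sumTo-binomial-upper-half n) ⟨
  H + sumTo n (λ i → suc (n + n) C (i + suc n))     ≡⟨ sumTo-++ n n (suc (n + n) C_) ⟨
  sumTo (n + suc n) (suc (n + n) C_)                ≡⟨ cong (λ k → sumTo k (suc (n + n) C_)) (+-suc n n) ⟩
  sumTo (suc (n + n)) (suc (n + n) C_)              ≡⟨ sumTo-binomial (suc (n + n)) ⟩
  2 * 2 ^ (n + n)                                   ≡⟨ cong (2 *_) four^n ⟨
  2 * 4 ^ n                                         ∎)
  where
  H : ℕ
  H = sumTo n (suc (n + n) C_)
  four^n : 4 ^ n ≡ 2 ^ (n + n)
  four^n = trans (^-*-assoc 2 2 n) (cong (λ k → 2 ^ (n + k)) (+-identityʳ n))

mainTheorem13 : (n : ℕ) → sumTo n (λ k → V n k) ≡ 4 ^ n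
mainTheorem13 n = begin
  sumTo n (λ k → V n k)                    ≡⟨ sumTo-cong n (V-entry n) ⟩
  sumTo n (λ k → suc (n + n) C (n ∸ k))    ≡⟨ sumTo-reverse n (suc (n + n) C_) ⟩
  sumTo n (suc (n + n) C_)                 ≡⟨ sumTo-binomial-lower-half n ⟩
  4 ^ n                                    ∎
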